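{- Let $E$ be a finite set, $(\sigma_\circ,\sigma_\bullet)$ an arbitrary pair in $S_E$ with synthetic genus $g$, let $a,b\in E$ be distinct, let $t\in S_E$ be the transposition exchanging $a$ and $b$, and let $g^t$ be the synthetic genus of $(\sigma_\circ^t,\sigma_\bullet)$. Then $g^t>g$ if and only if both: (1) at least one of $a,b$ lies in a $\sigma_\circ\sigma_\bullet$-orbit different from the orbits of the other three of $a,\sigma_\circ(a),b,\sigma_\circ(b)$; and (2) at least one of $\sigma_\circ(a),\sigma_\circ(b)$ lies in a $\sigma_\circ\sigma_\bullet$-orbit different from the orbits of the other three of $a,\sigma_\circ(a),b,\sigma_\circ(b)$. In this case $g^t=g+1$, and if $(\sigma_\circ,\sigma_\bullet)$ is transitive then $(\sigma_\circ^t,\sigma_\bullet)$ is also transitive. (It is not assumed that $a,\sigma_\circ(a),b$ are distinct.)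
   Context: Permutations compose functionally, $\pi^s=s\pi s^{ -1}$, $z(\pi)$ is the number of $\pi$-orbits (fixed points included), and a pair is transitive iff the subgroup it generates acts transitively. Synthetic genus of $(\sigma_\circ,\sigma_\bullet)$ in $S_E$: $g=1-\chi/2$ where $\chi=z(\sigma_\circ)+z(\sigma_\bullet)-|E|+z(\sigma_\circ\sigma_\bullet)$. -}

module Defs where

open import Data.Nat using (ℕ; zero; suc; _<_)
open import Data.Fin using (Fin; toℕ)
open import Data.Fin.Permutation using (Permutation′; _⟨$⟩ʳ_; _∘ₚ_; flip; transpose)
open import Data.Bool using (Bool; true; false; not; _∧_; _∨_)
open import Data.List using (List; []; _∷_; upTo; allFin; filter; length; map)
open import Data.Bool.ListAction using (any; all)
open import Data.Product using (∃-syntax)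
open import Data.Integer as ℤ using (ℤ; +_)
open import Data.Rational using (ℚ; 1ℚ; _/_; _-_)
open import Relation.Binary.PropositionalEquality using (_≡_)
open import Relation.Nullary.Decidable using (⌊_⌋)
import Data.Fin as F

-- S_E with E = Fin n.  Functional composition: (σ · τ) x = σ (τ x).
_·_ : ∀ {n} → Permutation′ n → Permutation′ n → Permutation′ n
σ · τ = τ ∘ₚ σ

conj : ∀ {n} → Permutation′ n → Permutation′ n → Permutation′ n
conj π s = (s · π) · flip s

iter : ∀ {n} → Permutation′ n → ℕ → Fin n → Fin n
iter π zero    x = x
iter π (suc k) x = π ⟨$⟩ʳ (iter π k x)

SameOrbit : ∀ {n} → Permutation′ n → Fin n → Fin n → Set
SameOrbit π x y = ∃[ k ] iter π k x ≡ y

-- Boolean orbit test; bounded search over k < n is complete since orbits have size ≤ n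
sameOrbit? : ∀ {n} → Permutation′ n → Fin n → Fin n → Bool
sameOrbit? {n} π x y = any (λ k → ⌊ iter π k x F.≟ y ⌋) (upTo n)

isOrbitMin : ∀ {n} → Permutation′ n → Fin n → Bool
isOrbitMin {n} π x =
  all (λ y → not (⌊ toℕ y Data.Nat.<? toℕ x ⌋ ∧ sameOrbit? π x y)) (allFin n)
  where import Data.Nat

-- z(π): number of π-orbits (fixed points included)
z : ∀ {n} → Permutation′ n → ℕ
z {n} π = length (filter (λ x → isOrbitMin π x Data.Bool.≟ true) (allFin n))
  where import Data.Bool

χ : ∀ {n} → Permutation′ n → Permutation′ n → ℤ
χ {n} σ∘ σ• = ((+ z σ∘) ℤ.+ (+ z σ•)) ℤ.- (+ n) ℤ.+ (+ z (σ∘ · σ•))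

genus : ∀ {n} → Permutation′ n → Permutation′ n → ℚ
genus σ∘ σ• = 1ℚ - (χ σ∘ σ• / 2)

data Reach {n} (σ∘ σ• : Permutation′ n) : Fin n → Fin n → Set where
  here  : ∀ {x} → Reach σ∘ σ• x x
  step∘ : ∀ {x y} → Reach σ∘ σ• x y → Reach σ∘ σ• x (σ∘ ⟨$⟩ʳ y)
  step• : ∀ {x y} → Reach σ∘ σ• x y → Reach σ∘ σ• x (σ• ⟨$⟩ʳ y)
  step∘⁻ : ∀ {x y} → Reach σ∘ σ• x y → Reach σ∘ σ• x (flip σ∘ ⟨$⟩ʳ y)
  step•⁻ : ∀ {x y} → Reach σ∘ σ• x y → Reach σ∘ σ• x (flip σ• ⟨$⟩ʳ y)

Transitive : ∀ {n} → Permutation′ n → Permutation′ n → Set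
Transitive {n} σ∘ σ• = ∀ (x y : Fin n) → Reach σ∘ σ• x y

Separated : ∀ {n} → Permutation′ n → Fin n → Fin n → Fin n → Fin n → Set
Separated φ u v w w' = ¬ SameOrbit φ u v × ¬ SameOrbit φ u w × ¬ SameOrbit φ u w'
  where open import Data.Product using (_×_)
        open import Relation.Nullary using (¬_)

-- Write φ = σ∘σ•. Since σ∘ (a b) = (σ∘a σ∘b) σ∘, the conjugate σ∘ᵗ equals (a b)(σ∘a σ∘b) σ∘, so it has as
-- many cycles as σ∘, and the face permutation of (σ∘ᵗ, σ•) is (a b)(σ∘a σ∘b) φ. Multiplying a permutation
-- on the left by a transposition (x y) merges the orbits of x and y if they are different and splits their
-- common orbit otherwise, changing the number of orbits by one. Only the number of faces therefore moves,
-- by −2, 0 or +2, and the genus rises, by exactly one, iff both transpositions merge: first σ∘a with σ∘b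
-- in φ, then a with b in (σ∘a σ∘b) φ. Conditions (1) and (2) restate this in terms of the φ-orbits of the
-- four points, and as the faces then only coarsen, transitivity is preserved.

module Submission where

open import Defs
open import Data.Bool using (true; false; T; not; _∧_)
import Data.Bool as Bool
open import Data.Bool.Properties using (T-≡; T?)
open import Data.Empty using (⊥-elim)
open import Data.Fin using (Fin; toℕ; _≟_)
open import Data.Fin.Permutation using (Permutation′; _⟨$⟩ʳ_; _⟨$⟩ˡ_; flip; transpose; inverseˡ; inverseʳ; _≈_)
open import Data.Fin.Properties using (pigeonhole; toℕ-injective; toℕ<n; any?)
open import Data.Integer as ℤ using (ℤ; +_)
import Data.Integer.Properties as ℤ
open import Data.Integer.Tactic.RingSolver using (solve-∀)
open import Data.List using ([]; _∷_; upTo; allFin; filter; length)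
open import Data.List.Membership.Propositional using (_∈_; lose)
open import Data.List.Membership.Propositional.Properties using (∈-upTo⁺; ∈-allFin)
open import Data.List.Properties using (filter-≐)
open import Data.List.Relation.Unary.All as All using (All; []; _∷_)
open import Data.List.Relation.Unary.All.Properties using (all⁺; all⁻)
open import Data.List.Relation.Unary.AllPairs using ([]; _∷_)
open import Data.List.Relation.Unary.Any as Any using (here; there)
open import Data.List.Relation.Unary.Any.Properties using (any⁺; any⁻)
open import Data.List.Relation.Unary.Unique.Propositional using (Unique)
open import Data.List.Relation.Unary.Unique.Propositional.Properties using (allFin⁺)
open import Data.Nat as ℕ using (ℕ; zero; suc; _+_; _*_; _∸_; _<_; _≤_; z≤n; s≤s)
import Data.Nat.DivMod as ℕ
import Data.Nat.Properties as ℕ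
open import Data.Product using (∃-syntax; _×_; _,_)
open import Data.Rational as ℚ using (ℚ; 1ℚ; _/_; _-_; toℚᵘ)
import Data.Rational.Properties as ℚ
import Data.Rational.Solver as ℚ
open import Data.Rational.Unnormalised as ℚᵘ using (mkℚᵘ; *≡*)
import Data.Rational.Unnormalised.Properties as ℚᵘ
open import Data.Sum as Sum using (_⊎_; inj₁; inj₂)
open import Function using (_∘_; _⇔_; mk⇔; Equivalence; Injection)
open import Function.Properties.Inverse using (↔⇒↣)
open Equivalence using (to; from)
open import Relation.Binary.Definitions using (Tri; tri<; tri≈; tri>)
open import Relation.Binary.PropositionalEquality
open import Relation.Nullary using (¬_; Dec; yes; no; contradiction)
open import Relation.Nullary.Decidable
  using (⌊_⌋; ¬?; dec-true; dec-false; toWitness; fromWitness; map′; _×-dec_; _⊎-dec_)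
open import Relation.Unary using (Pred; Decidable)

module _ {ℓ} {P : Pred ℕ ℓ} (P? : Decidable P) where

  private
    firstBelow : ∀ k → (∃[ m ] (P m × m < k × (∀ {j} → j < m → ¬ P j)))
                      ⊎ (∀ {j} → j < k → ¬ P j)
    firstBelow zero = inj₂ λ ()
    firstBelow (suc k) with firstBelow k
    ... | inj₁ (m , pm , m<k , below) = inj₁ (m , pm , ℕ.m≤n⇒m≤1+n m<k , below)
    ... | inj₂ none with P? k
    ...   | yes pk = inj₁ (k , pk , ℕ.n<1+n k , none)
    ...   | no ¬pk = inj₂ λ j<1+k → Sum.[ none , (λ { refl → ¬pk }) ]′ (ℕ.m≤n⇒m<n∨m≡n (ℕ.≤-pred j<1+k))

  minimal-witness : ∀ {k} → P k → ∃[ m ] (P m × (∀ {j} → j < m → ¬ P j))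
  minimal-witness {k} pk with firstBelow (suc k)
  ... | inj₁ (m , pm , _ , below) = m , pm , below
  ... | inj₂ none = contradiction pk (none (ℕ.n<1+n k))

module _ {a ℓ₁ ℓ₂} {A : Set a} {P : Pred A ℓ₁} {Q : Pred A ℓ₂} (P? : Decidable P) (Q? : Decidable Q) where

  private
    length-filter-cong : ∀ {xs} → All (λ x → P x ⇔ Q x) xs →
                         length (filter P? xs) ≡ length (filter Q? xs)
    length-filter-cong [] = refl
    length-filter-cong {x ∷ _} (p⇔q ∷ rest) with P? x | Q? x
    ... | yes _  | yes _  = cong suc (length-filter-cong rest)
    ... | no _   | no _   = length-filter-cong rest
    ... | yes px | no ¬qx = contradiction (to p⇔q px) ¬qx
    ... | no ¬px | yes qx = contradiction (from p⇔q qx) ¬px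

  length-filter-except : ∀ {x₀ xs} → Unique xs → x₀ ∈ xs → P x₀ → ¬ Q x₀ →
                         (∀ {x} → x ≢ x₀ → P x ⇔ Q x) →
                         length (filter P? xs) ≡ suc (length (filter Q? xs))
  length-filter-except {x₀} (x₀∉ ∷ _) (here refl) px₀ ¬qx₀ agree with P? x₀ | Q? x₀
  ... | yes _   | no _    = cong suc (length-filter-cong (All.map (λ x₀≢x → agree (x₀≢x ∘ sym)) x₀∉))
  ... | no ¬px₀ | _       = contradiction px₀ ¬px₀
  ... | _       | yes qx₀ = contradiction qx₀ ¬qx₀
  length-filter-except {x₀} {x ∷ _} (x∉ ∷ unique) (there x₀∈) px₀ ¬qx₀ agree
    with P? x | Q? x | agree (λ x≡x₀ → All.lookup x∉ x₀∈ x≡x₀)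
  ... | yes _  | yes _  | _   = cong suc (length-filter-except unique x₀∈ px₀ ¬qx₀ agree)
  ... | no _   | no _   | _   = length-filter-except unique x₀∈ px₀ ¬qx₀ agree
  ... | yes px | no ¬qx | p⇔q = contradiction (to p⇔q px) ¬qx
  ... | no ¬px | yes qx | p⇔q = contradiction (from p⇔q qx) ¬px

module Orbits {n} (π : Permutation′ n) where

  infix 4 _∼_ _∼?_

  _∼_ : Fin n → Fin n → Set
  _∼_ = SameOrbit π

  π-injective : ∀ {x y} → π ⟨$⟩ʳ x ≡ π ⟨$⟩ʳ y → x ≡ y
  π-injective = Injection.injective (↔⇒↣ π)

  iter-+ : ∀ i j x → iter π (i + j) x ≡ iter π i (iter π j x)
  iter-+ zero    j x = refl
  iter-+ (suc i) j x = cong (π ⟨$⟩ʳ_) (iter-+ i j x)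

  iter-comm : ∀ i j x → iter π i (iter π j x) ≡ iter π j (iter π i x)
  iter-comm i j x = begin
    iter π i (iter π j x)  ≡⟨ iter-+ i j x ⟨
    iter π (i + j) x       ≡⟨ cong (λ k → iter π k x) (ℕ.+-comm i j) ⟩
    iter π (j + i) x       ≡⟨ iter-+ j i x ⟩
    iter π j (iter π i x)  ∎
    where open ≡-Reasoning

  iter-injective : ∀ k {x y} → iter π k x ≡ iter π k y → x ≡ y
  iter-injective zero    e = e
  iter-injective (suc k) e = iter-injective k (π-injective e)

  iter-period : ∀ x → ∃[ p ] (iter π (suc p) x ≡ x × suc p ≤ n)
  iter-period x with pigeonhole (ℕ.n<1+n n) (λ (i : Fin (suc n)) → iter π (toℕ i) x)
  ... | i , j , i<j , πⁱx≡πʲx with ℕ.m≤n⇒∃[o]m+o≡n i<j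
  ...   | p , i+1+p≡j = p , returns , bound
    where
      returns : iter π (suc p) x ≡ x
      returns = iter-injective (toℕ i) (begin
        iter π (toℕ i) (iter π (suc p) x)  ≡⟨ iter-comm (toℕ i) (suc p) x ⟩
        iter π (suc p) (iter π (toℕ i) x)  ≡⟨ iter-+ (suc p) (toℕ i) x ⟨
        iter π (suc p + toℕ i) x           ≡⟨ cong (λ k → iter π (suc k) x) (ℕ.+-comm p (toℕ i)) ⟩
        iter π (suc (toℕ i) + p) x         ≡⟨ cong (λ k → iter π k x) i+1+p≡j ⟩
        iter π (toℕ j) x                   ≡⟨ πⁱx≡πʲx ⟨
        iter π (toℕ i) x                   ∎)
        where open ≡-Reasoning
      bound : suc p ≤ n
      bound = begin
        suc p           ≤⟨ s≤s (ℕ.m≤n+m p (toℕ i)) ⟩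
        suc (toℕ i) + p ≡⟨ i+1+p≡j ⟩
        toℕ j           ≤⟨ ℕ.≤-pred (toℕ<n j) ⟩
        n               ∎
        where open ℕ.≤-Reasoning

  iter-*-period : ∀ {p x} → iter π p x ≡ x → ∀ q → iter π (q * p) x ≡ x
  iter-*-period e zero    = refl
  iter-*-period {p} {x} e (suc q) = begin
    iter π (p + q * p) x          ≡⟨ iter-+ p (q * p) x ⟩
    iter π p (iter π (q * p) x)   ≡⟨ cong (iter π p) (iter-*-period e q) ⟩
    iter π p x                    ≡⟨ e ⟩
    x                             ∎
    where open ≡-Reasoning

  ∼-refl : ∀ {x} → x ∼ x
  ∼-refl = 0 , refl

  ∼-step : ∀ x → x ∼ π ⟨$⟩ʳ x
  ∼-step x = 1 , refl

  ∼-trans : ∀ {x y w} → x ∼ y → y ∼ w → x ∼ w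
  ∼-trans {x} (k , refl) (l , refl) = l + k , iter-+ l k x

  ∼-sym : ∀ {x y} → x ∼ y → y ∼ x
  ∼-sym {x} (k , refl) with iter-period x
  ... | p , returns , _ = k * suc p ∸ k , (begin
    iter π (k * suc p ∸ k) (iter π k x)  ≡⟨ iter-+ (k * suc p ∸ k) k x ⟨
    iter π (k * suc p ∸ k + k) x         ≡⟨ cong (λ m → iter π m x) (ℕ.m∸n+n≡m (ℕ.m≤m*n k (suc p))) ⟩
    iter π (k * suc p) x                 ≡⟨ iter-*-period returns k ⟩
    x                                    ∎)
    where open ≡-Reasoning

  ∼-bounded : ∀ {x y} → x ∼ y → ∃[ k ] (k < n × iter π k x ≡ y)
  ∼-bounded {x} (k , refl) with iter-period x
  ... | p , returns , bound = r , ℕ.<-≤-trans (ℕ.m%n<n k (suc p)) bound , (begin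
    iter π r x                        ≡⟨ cong (iter π r) (iter-*-period returns q) ⟨
    iter π r (iter π (q * suc p) x)   ≡⟨ iter-+ r (q * suc p) x ⟨
    iter π (r + q * suc p) x          ≡⟨ cong (λ m → iter π m x) (ℕ.m≡m%n+[m/n]*n k (suc p)) ⟨
    iter π k x                        ∎)
    where
      open ≡-Reasoning
      r q : ℕ
      r = k ℕ.% suc p
      q = k ℕ./ suc p

  sameOrbit?-sound : ∀ {x y} → T (sameOrbit? π x y) → x ∼ y
  sameOrbit?-sound t with Any.satisfied (any⁻ _ (upTo n) t)
  ... | k , found = k , toWitness found

  sameOrbit?-complete : ∀ {x y} → x ∼ y → T (sameOrbit? π x y)
  sameOrbit?-complete x∼y with ∼-bounded x∼y
  ... | k , k<n , e = any⁺ _ (lose (∈-upTo⁺ k<n) (fromWitness e))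

  _∼?_ : ∀ x y → Dec (x ∼ y)
  x ∼? y = map′ sameOrbit?-sound sameOrbit?-complete (T? (sameOrbit? π x y))

  IsOrbitMin : Fin n → Set
  IsOrbitMin x = isOrbitMin π x ≡ true

  isOrbitMin? : Decidable IsOrbitMin
  isOrbitMin? x = isOrbitMin π x Bool.≟ true

  private
    isOrbitMin-entry⇔ : ∀ x y → T (not (⌊ toℕ y ℕ.<? toℕ x ⌋ ∧ sameOrbit? π x y)) ⇔ (toℕ y < toℕ x → ¬ x ∼ y)
    isOrbitMin-entry⇔ x y with toℕ y ℕ.<? toℕ x
    ... | no y≮x = mk⇔ (λ _ y<x → contradiction y<x y≮x) _
    ... | yes y<x with sameOrbit? π x y in e
    ...   | false = mk⇔ (λ _ _ x∼y → subst T e (sameOrbit?-complete x∼y)) _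
    ...   | true  = mk⇔ (λ ()) (λ below → below y<x (sameOrbit?-sound (subst T (sym e) _)))

  isOrbitMin⇔ : ∀ {x} → IsOrbitMin x ⇔ (∀ {y} → toℕ y < toℕ x → ¬ x ∼ y)
  isOrbitMin⇔ {x} = mk⇔
    (λ min {y} → to (isOrbitMin-entry⇔ x y) (All.lookup (all⁺ _ _ (from T-≡ min)) (∈-allFin y)))
    (λ below → to T-≡ (all⁻ _ {xs = allFin n} (All.tabulate λ {y} _ → from (isOrbitMin-entry⇔ x y) below)))

  orbitMin : ∀ x → ∃[ m ] (x ∼ m × IsOrbitMin m)
  orbitMin x with minimal-witness reached? {toℕ x} (x , refl , ∼-refl)
    where
      reached? : ∀ k → Dec (∃[ y ] (toℕ y ≡ k × x ∼ y))
      reached? k = any? λ y → (toℕ y ℕ.≟ k) ×-dec (x ∼? y)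
  ... | _ , (m , refl , x∼m) , none = m , x∼m , from isOrbitMin⇔
        λ {y} y<m m∼y → none y<m (y , refl , ∼-trans x∼m m∼y)

  orbitMin-unique : ∀ {m m′} → IsOrbitMin m → IsOrbitMin m′ → m ∼ m′ → m ≡ m′
  orbitMin-unique {m} {m′} min min′ m∼m′ with ℕ.<-cmp (toℕ m) (toℕ m′)
  ... | tri< m<m′ _ _ = contradiction (∼-sym m∼m′) (to isOrbitMin⇔ min′ m<m′)
  ... | tri≈ _ m≡m′ _ = toℕ-injective m≡m′
  ... | tri> _ _ m>m′ = contradiction m∼m′ (to isOrbitMin⇔ min m>m′)

module _ {n} {π π′ : Permutation′ n} (π≈π′ : π ≈ π′) where

  iter-cong : ∀ k x → iter π k x ≡ iter π′ k x
  iter-cong zero    x = refl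
  iter-cong (suc k) x = trans (cong (π ⟨$⟩ʳ_) (iter-cong k x)) (π≈π′ _)

  sameOrbit-cong : ∀ {x y} → SameOrbit π x y → SameOrbit π′ x y
  sameOrbit-cong (k , e) = k , trans (sym (iter-cong k _)) e

z-cong : ∀ {n} {π π′ : Permutation′ n} → π ≈ π′ → z π ≡ z π′
z-cong {n} {π} {π′} π≈π′ =
  cong length (filter-≐ (Orbits.isOrbitMin? π) (Orbits.isOrbitMin? π′)
    (isOrbitMin-cong {π} {π′} π≈π′ , isOrbitMin-cong {π′} {π} (sym ∘ π≈π′)) (allFin n))
  where
    isOrbitMin-cong : ∀ {ψ ψ′} → ψ ≈ ψ′ → ∀ {x} → Orbits.IsOrbitMin ψ x → Orbits.IsOrbitMin ψ′ x
    isOrbitMin-cong {ψ} {ψ′} ψ≈ψ′ {x} min = from (Orbits.isOrbitMin⇔ ψ′ {x})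
      λ y<x x∼′y → to (Orbits.isOrbitMin⇔ ψ {x}) min y<x (sameOrbit-cong {π = ψ′} {ψ} (sym ∘ ψ≈ψ′) x∼′y)

module _ {n} (i j : Fin n) where

  transpose-mapsˡ : transpose i j ⟨$⟩ʳ i ≡ j
  transpose-mapsˡ rewrite dec-true (i ≟ i) refl = refl

  transpose-mapsʳ : transpose i j ⟨$⟩ʳ j ≡ i
  transpose-mapsʳ with j ≟ i
  ... | yes j≡i = j≡i
  ... | no _ rewrite dec-true (j ≟ j) refl = refl

  transpose-fixes : ∀ {k} → k ≢ i → k ≢ j → transpose i j ⟨$⟩ʳ k ≡ k
  transpose-fixes {k} k≢i k≢j rewrite dec-false (k ≟ i) k≢i | dec-false (k ≟ j) k≢j = refl

  transpose-involutive : ∀ k → transpose i j ⟨$⟩ʳ (transpose i j ⟨$⟩ʳ k) ≡ k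
  transpose-involutive k = cases (k ≟ i) (k ≟ j)
    where
      t : Fin n → Fin n
      t = transpose i j ⟨$⟩ʳ_
      cases : Dec (k ≡ i) → Dec (k ≡ j) → t (t k) ≡ k
      cases (yes refl) _          = trans (cong t transpose-mapsˡ) transpose-mapsʳ
      cases (no _)     (yes refl) = trans (cong t transpose-mapsʳ) transpose-mapsˡ
      cases (no k≢i)   (no k≢j)   = trans (cong t (transpose-fixes k≢i k≢j)) (transpose-fixes k≢i k≢j)

  transpose-self-inverse : flip (transpose i j) ≈ transpose i j
  transpose-self-inverse k =
    trans (cong (transpose i j ⟨$⟩ˡ_) (sym (transpose-involutive k))) (inverseˡ (transpose i j))

transpose-natural : ∀ {n} (σ : Permutation′ n) (i j k : Fin n) →
                    σ ⟨$⟩ʳ (transpose i j ⟨$⟩ʳ k) ≡ transpose (σ ⟨$⟩ʳ i) (σ ⟨$⟩ʳ j) ⟨$⟩ʳ (σ ⟨$⟩ʳ k)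
transpose-natural {n} σ i j k = cases (k ≟ i) (k ≟ j)
  where
    open Orbits σ using (π-injective)
    s : Fin n → Fin n
    s = σ ⟨$⟩ʳ_
    cases : Dec (k ≡ i) → Dec (k ≡ j) → s (transpose i j ⟨$⟩ʳ k) ≡ transpose (s i) (s j) ⟨$⟩ʳ s k
    cases (yes refl) _          = trans (cong s (transpose-mapsˡ i j)) (sym (transpose-mapsˡ (s i) (s j)))
    cases (no _)     (yes refl) = trans (cong s (transpose-mapsʳ i j)) (sym (transpose-mapsʳ (s i) (s j)))
    cases (no k≢i)   (no k≢j)   = trans (cong s (transpose-fixes i j k≢i k≢j))
                                    (sym (transpose-fixes (s i) (s j) (k≢i ∘ π-injective) (k≢j ∘ π-injective)))

conj-transpose : ∀ {n} (σ : Permutation′ n) (a b : Fin n) →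
                 conj σ (transpose a b) ≈ transpose a b · (transpose (σ ⟨$⟩ʳ a) (σ ⟨$⟩ʳ b) · σ)
conj-transpose σ a b k =
  cong (transpose a b ⟨$⟩ʳ_) (trans (cong (σ ⟨$⟩ʳ_) (transpose-self-inverse a b k)) (transpose-natural σ a b k))

InOrbitsOf : ∀ {n} → Permutation′ n → Fin n → Fin n → Fin n → Set
InOrbitsOf ψ x y u = SameOrbit ψ u x ⊎ SameOrbit ψ u y

module Transposed {n} (ψ : Permutation′ n) (x y : Fin n) where

  ψ′ : Permutation′ n
  ψ′ = transpose x y · ψ

  open Orbits ψ
  open Orbits ψ′ using () renaming
    (_∼_ to _∼′_; ∼-trans to ∼′-trans; ∼-sym to ∼′-sym; IsOrbitMin to IsOrbitMin′;
     isOrbitMin⇔ to isOrbitMin′⇔; isOrbitMin? to isOrbitMin′?)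

  ψ′-redirectsˡ : ∀ {w} → ψ ⟨$⟩ʳ w ≡ x → ψ′ ⟨$⟩ʳ w ≡ y
  ψ′-redirectsˡ e = trans (cong (transpose x y ⟨$⟩ʳ_) e) (transpose-mapsˡ x y)

  ψ′-redirectsʳ : ∀ {w} → ψ ⟨$⟩ʳ w ≡ y → ψ′ ⟨$⟩ʳ w ≡ x
  ψ′-redirectsʳ e = trans (cong (transpose x y ⟨$⟩ʳ_) e) (transpose-mapsʳ x y)

  ψ′-agrees : ∀ {w} → ψ ⟨$⟩ʳ w ≢ x → ψ ⟨$⟩ʳ w ≢ y → ψ′ ⟨$⟩ʳ w ≡ ψ ⟨$⟩ʳ w
  ψ′-agrees = transpose-fixes x y

  inOrbitsOf-∼ : ∀ {u v} → u ∼ v → InOrbitsOf ψ x y v → InOrbitsOf ψ x y u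
  inOrbitsOf-∼ u∼v (inj₁ v∼x) = inj₁ (∼-trans u∼v v∼x)
  inOrbitsOf-∼ u∼v (inj₂ v∼y) = inj₂ (∼-trans u∼v v∼y)

  module Merging (x≁y : ¬ x ∼ y) where

    private
      module Follow {p q} (q≁p : ¬ q ∼ p) (redirects : ∀ {w} → ψ ⟨$⟩ʳ w ≡ p → ψ′ ⟨$⟩ʳ w ≡ q)
                    (agrees : ∀ {w} → ψ ⟨$⟩ʳ w ≢ p → ψ ⟨$⟩ʳ w ≢ q → ψ′ ⟨$⟩ʳ w ≡ ψ ⟨$⟩ʳ w) where

        reaches : ∀ k w → iter ψ (suc k) w ≡ p → w ∼′ q
        reaches zero    w e = 1 , redirects e
        reaches (suc k) w e with ψ ⟨$⟩ʳ w ≟ p | ψ ⟨$⟩ʳ w ≟ q | trans (iter-comm (suc k) 1 w) e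
        ... | yes ψw≡p | _        | _  = 1 , redirects ψw≡p
        ... | no _     | yes refl | e′ = contradiction (suc k , e′) q≁p
        ... | no ψw≢p  | no ψw≢q  | e′ = ∼′-trans (1 , agrees ψw≢p ψw≢q) (reaches k (ψ ⟨$⟩ʳ w) e′)

        follow : ∀ {w} → w ∼ p → w ∼′ q
        follow (suc k , e) = reaches k _ e
        follow (zero , refl) with iter-period p
        ... | r , returns , _ = reaches r p returns

    ∼x⇒∼′y : ∀ {w} → w ∼ x → w ∼′ y
    ∼x⇒∼′y = Follow.follow (x≁y ∘ ∼-sym) ψ′-redirectsˡ ψ′-agrees

    ∼y⇒∼′x : ∀ {w} → w ∼ y → w ∼′ x
    ∼y⇒∼′x = Follow.follow x≁y ψ′-redirectsʳ (λ ≢y ≢x → ψ′-agrees ≢x ≢y)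

    inOrbitsOf⇒∼′y : ∀ {u} → InOrbitsOf ψ x y u → u ∼′ y
    inOrbitsOf⇒∼′y (inj₁ u∼x) = ∼x⇒∼′y u∼x
    inOrbitsOf⇒∼′y (inj₂ u∼y) = ∼′-trans (∼y⇒∼′x u∼y) (∼x⇒∼′y ∼-refl)

    iter-outside : ∀ {u} → ¬ InOrbitsOf ψ x y u → ∀ k → iter ψ′ k u ≡ iter ψ k u
    iter-outside u∉ zero    = refl
    iter-outside u∉ (suc k) = trans (cong (ψ′ ⟨$⟩ʳ_) (iter-outside u∉ k))
      (ψ′-agrees (λ e → u∉ (inj₁ (suc k , e))) (λ e → u∉ (inj₂ (suc k , e))))

    Merged : Fin n → Fin n → Set
    Merged u v = u ∼ v ⊎ (InOrbitsOf ψ x y u × InOrbitsOf ψ x y v)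

    private
      merged-trans : ∀ {u v w} → Merged u v → Merged v w → Merged u w
      merged-trans (inj₁ u∼v)      (inj₁ v∼w)      = inj₁ (∼-trans u∼v v∼w)
      merged-trans (inj₁ u∼v)      (inj₂ (v∈ , w∈)) = inj₂ (inOrbitsOf-∼ u∼v v∈ , w∈)
      merged-trans (inj₂ (u∈ , v∈)) (inj₁ v∼w)      = inj₂ (u∈ , inOrbitsOf-∼ (∼-sym v∼w) v∈)
      merged-trans (inj₂ (u∈ , _))  (inj₂ (_ , w∈))  = inj₂ (u∈ , w∈)

      merged-step : ∀ w → Merged w (ψ′ ⟨$⟩ʳ w)
      merged-step w = cases (ψ ⟨$⟩ʳ w ≟ x) (ψ ⟨$⟩ʳ w ≟ y)
        where
          cases : Dec (ψ ⟨$⟩ʳ w ≡ x) → Dec (ψ ⟨$⟩ʳ w ≡ y) → Merged w (ψ′ ⟨$⟩ʳ w)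
          cases (yes ψw≡x) _          = inj₂ (inj₁ (1 , ψw≡x) , inj₂ (0 , ψ′-redirectsˡ ψw≡x))
          cases (no _)     (yes ψw≡y) = inj₂ (inj₂ (1 , ψw≡y) , inj₁ (0 , ψ′-redirectsʳ ψw≡y))
          cases (no ψw≢x)  (no ψw≢y)  = inj₁ (1 , sym (ψ′-agrees ψw≢x ψw≢y))

      merged-iter : ∀ k u → Merged u (iter ψ′ k u)
      merged-iter zero    u = inj₁ ∼-refl
      merged-iter (suc k) u = merged-trans (merged-iter k u) (merged-step (iter ψ′ k u))

    ∼′⇔merged : ∀ {u v} → u ∼′ v ⇔ Merged u v
    ∼′⇔merged = mk⇔ (λ { (k , refl) → merged-iter k _ }) merged⇒∼′
      where
        merged⇒∼′ : ∀ {u v} → Merged u v → u ∼′ v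
        merged⇒∼′ (inj₂ (u∈ , v∈)) = ∼′-trans (inOrbitsOf⇒∼′y u∈) (∼′-sym (inOrbitsOf⇒∼′y v∈))
        merged⇒∼′ {u} (inj₁ (k , e)) with (u ∼? x) ⊎-dec (u ∼? y)
        ... | yes u∈ = merged⇒∼′ (inj₂ (u∈ , inOrbitsOf-∼ (∼-sym (k , e)) u∈))
        ... | no u∉  = k , trans (iter-outside u∉ k) e

    -- Orbits are counted by their least elements, and the least elements of the ψ′-orbits are those of
    -- the ψ-orbits except m₂, the larger of the least elements of the two merged orbits.
    private
      module _ {m₁ m₂} (m₁<m₂ : toℕ m₁ < toℕ m₂) (min₁ : IsOrbitMin m₁) (min₂ : IsOrbitMin m₂)
               (m₁∈ : InOrbitsOf ψ x y m₁) (m₂∈ : InOrbitsOf ψ x y m₂)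
               (classify : ∀ {u} → InOrbitsOf ψ x y u → u ∼ m₁ ⊎ u ∼ m₂) where

        ¬isOrbitMin′-m₂ : ¬ IsOrbitMin′ m₂
        ¬isOrbitMin′-m₂ min′ = to isOrbitMin′⇔ min′ m₁<m₂ (from ∼′⇔merged (inj₂ (m₂∈ , m₁∈)))

        isOrbitMin⇒isOrbitMin′ : ∀ {w} → w ≢ m₂ → IsOrbitMin w → IsOrbitMin′ w
        isOrbitMin⇒isOrbitMin′ {w} w≢m₂ min = from isOrbitMin′⇔ λ v<w w∼′v →
          no-smaller-merged v<w (to ∼′⇔merged w∼′v)
          where
            smaller : ∀ {v} → toℕ v < toℕ w → ¬ w ∼ v
            smaller = to isOrbitMin⇔ min
            no-smaller-merged : ∀ {v} → toℕ v < toℕ w → ¬ Merged w v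
            no-smaller-merged v<w (inj₁ w∼v) = smaller v<w w∼v
            no-smaller-merged v<w (inj₂ (w∈ , v∈)) with classify w∈
            ... | inj₂ w∼m₂ = w≢m₂ (orbitMin-unique min min₂ w∼m₂)
            ... | inj₁ w∼m₁ with orbitMin-unique min min₁ w∼m₁ | classify v∈
            ...   | refl | inj₁ v∼m₁ = smaller v<w (∼-sym v∼m₁)
            ...   | refl | inj₂ v∼m₂ = to isOrbitMin⇔ min₂ (ℕ.<-trans v<w m₁<m₂) (∼-sym v∼m₂)

        isOrbitMin′⇒isOrbitMin : ∀ {w} → IsOrbitMin′ w → IsOrbitMin w
        isOrbitMin′⇒isOrbitMin min′ = from isOrbitMin⇔ λ v<w w∼v →
          to isOrbitMin′⇔ min′ v<w (from ∼′⇔merged (inj₁ w∼v))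

        z-drops : z ψ ≡ suc (z ψ′)
        z-drops = length-filter-except isOrbitMin? isOrbitMin′? (allFin⁺ n) (∈-allFin m₂) min₂ ¬isOrbitMin′-m₂
          λ w≢m₂ → mk⇔ (isOrbitMin⇒isOrbitMin′ w≢m₂) isOrbitMin′⇒isOrbitMin

    z-merge : z ψ ≡ suc (z ψ′)
    z-merge with orbitMin x | orbitMin y
    ... | mx , x∼mx , min-x | my , y∼my , min-y = by-order (ℕ.<-cmp (toℕ mx) (toℕ my))
      where
        classify : ∀ {u} → InOrbitsOf ψ x y u → u ∼ mx ⊎ u ∼ my
        classify = Sum.map (λ u∼x → ∼-trans u∼x x∼mx) (λ u∼y → ∼-trans u∼y y∼my)
        by-order : Tri (toℕ mx < toℕ my) (toℕ mx ≡ toℕ my) (toℕ my < toℕ mx) → z ψ ≡ suc (z ψ′)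
        by-order (tri< mx<my _ _) =
          z-drops mx<my min-x min-y (inj₁ (∼-sym x∼mx)) (inj₂ (∼-sym y∼my)) classify
        by-order (tri> _ _ my<mx) =
          z-drops my<mx min-y min-x (inj₂ (∼-sym y∼my)) (inj₁ (∼-sym x∼mx)) (Sum.swap ∘ classify)
        by-order (tri≈ _ mx≡my _) =
          contradiction (∼-trans x∼mx (subst (_∼ y) (sym (toℕ-injective mx≡my)) (∼-sym y∼my))) x≁y

  -- For k least with ψᵏ x = y, the ψ′-orbit of x is {ψʲ x | j < k}, which misses y.
  ∼⇒≁′ : x ≢ y → x ∼ y → ¬ x ∼′ y
  ∼⇒≁′ x≢y (k₀ , ψᵏ⁰x≡y) (m , ψ′ᵐx≡y)
    with minimal-witness {P = λ k → iter ψ k x ≡ y} (λ k → iter ψ k x ≟ y) {k₀} ψᵏ⁰x≡y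
  ... | k , ψᵏx≡y , before = y-off-path (subst OnPath ψ′ᵐx≡y (onPath-iter m))
    where
      OnPath : Fin n → Set
      OnPath w = ∃[ j ] (j < k × iter ψ j x ≡ w)

      0<k : 0 < k
      0<k = ℕ.n≢0⇒n>0 λ { refl → x≢y ψᵏx≡y }

      not-back : ∀ {j} → suc j < k → iter ψ (suc j) x ≢ x
      not-back {j} 1+j<k ψ¹⁺ʲx≡x = before (ℕ.∸-monoʳ-< {k} {suc j} {0} (s≤s z≤n) (ℕ.<⇒≤ 1+j<k)) (begin
        iter ψ (k ∸ suc j) x                    ≡⟨ cong (iter ψ (k ∸ suc j)) ψ¹⁺ʲx≡x ⟨
        iter ψ (k ∸ suc j) (iter ψ (suc j) x)   ≡⟨ iter-+ (k ∸ suc j) (suc j) x ⟨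
        iter ψ (k ∸ suc j + suc j) x            ≡⟨ cong (λ i → iter ψ i x) (ℕ.m∸n+n≡m (ℕ.<⇒≤ 1+j<k)) ⟩
        iter ψ k x                              ≡⟨ ψᵏx≡y ⟩
        y                                       ∎)
        where open ≡-Reasoning

      onPath-step : ∀ {w} → OnPath w → OnPath (ψ′ ⟨$⟩ʳ w)
      onPath-step (j , j<k , refl) with suc j ℕ.≟ k
      ... | yes refl    = 0 , 0<k , sym (ψ′-redirectsʳ ψᵏx≡y)
      ... | no 1+j≢k    = suc j , 1+j<k , sym (ψ′-agrees (not-back 1+j<k) (before 1+j<k))
        where
          1+j<k : suc j < k
          1+j<k = ℕ.≤∧≢⇒< j<k 1+j≢k

      onPath-iter : ∀ m → OnPath (iter ψ′ m x)
      onPath-iter zero    = 0 , 0<k , refl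
      onPath-iter (suc m) = onPath-step (onPath-iter m)

      y-off-path : ¬ OnPath y
      y-off-path (j , j<k , ψʲx≡y) = before j<k ψʲx≡y

module _ {n} (ψ : Permutation′ n) {x y : Fin n} where

  sameOrbit-transpose⇔ : ¬ SameOrbit ψ x y → ∀ {u v} →
                         SameOrbit (transpose x y · ψ) u v ⇔
                         (SameOrbit ψ u v ⊎ (InOrbitsOf ψ x y u × InOrbitsOf ψ x y v))
  sameOrbit-transpose⇔ x≁y = Transposed.Merging.∼′⇔merged ψ x y x≁y

  sameOrbit-transpose-split : x ≢ y → SameOrbit ψ x y → ¬ SameOrbit (transpose x y · ψ) x y
  sameOrbit-transpose-split = Transposed.∼⇒≁′ ψ x y

  z-transpose-merge : ¬ SameOrbit ψ x y → z ψ ≡ suc (z (transpose x y · ψ))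
  z-transpose-merge = Transposed.Merging.z-merge ψ x y

  z-transpose-split : x ≢ y → SameOrbit ψ x y → z (transpose x y · ψ) ≡ suc (z ψ)
  z-transpose-split x≢y x∼y = trans
    (Transposed.Merging.z-merge (transpose x y · ψ) x y (sameOrbit-transpose-split x≢y x∼y))
    (cong suc (z-cong λ w → transpose-involutive x y (ψ ⟨$⟩ʳ w)))

-- Of the two transpositions given by conj-transpose, one merges two orbits and the other splits one.
z-conj-transpose : ∀ {n} (σ : Permutation′ n) {a b : Fin n} → a ≢ b → z (conj σ (transpose a b)) ≡ z σ
z-conj-transpose σ {a} {b} a≢b = trans (z-cong (conj-transpose σ a b)) (by-cases (σa ∼? σb))
  where
    open Orbits σ using (π-injective; _∼_; _∼?_; ∼-refl)
    σa σb : Fin _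
    σa = σ ⟨$⟩ʳ a
    σb = σ ⟨$⟩ʳ b
    ρ : Permutation′ _
    ρ = transpose σa σb · σ
    module ρ = Orbits ρ

    a∼ρb⇔σa∼ρσb : a ρ.∼ b ⇔ σa ρ.∼ σb
    a∼ρb⇔σa∼ρσb = mk⇔
      (λ a∼b → ρ.∼-trans (ρ.∼-sym b∼σa) (ρ.∼-trans (ρ.∼-sym a∼b) a∼σb))
      (λ σa∼σb → ρ.∼-trans a∼σb (ρ.∼-trans (ρ.∼-sym σa∼σb) (ρ.∼-sym b∼σa)))
      where
        a∼σb : a ρ.∼ σb
        a∼σb = subst (a ρ.∼_) (transpose-mapsˡ σa σb) (ρ.∼-step a)
        b∼σa : b ρ.∼ σa
        b∼σa = subst (b ρ.∼_) (transpose-mapsʳ σa σb) (ρ.∼-step b)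

    by-cases : Dec (σa ∼ σb) → z (transpose a b · ρ) ≡ z σ
    by-cases (yes σa∼σb) = ℕ.suc-injective (trans
      (sym (z-transpose-merge ρ (sameOrbit-transpose-split σ (a≢b ∘ π-injective) σa∼σb ∘ to a∼ρb⇔σa∼ρσb)))
      (z-transpose-split σ (a≢b ∘ π-injective) σa∼σb))
    by-cases (no σa≁σb) = trans
      (z-transpose-split ρ a≢b (from a∼ρb⇔σa∼ρσb
        (from (sameOrbit-transpose⇔ σ σa≁σb) (inj₂ (inj₁ ∼-refl , inj₂ ∼-refl)))))
      (sym (z-transpose-merge σ σa≁σb))

module _ {n} (ψ : Permutation′ n) {p q x y : Fin n} where

  private
    ρ ψ″ : Permutation′ n
    ρ  = transpose p q · ψ
    ψ″ = transpose x y · ρ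

  z-transpose²-drop : ¬ SameOrbit ψ p q → ¬ SameOrbit ρ x y → z ψ ≡ 2 + z ψ″
  z-transpose²-drop p≁q x≁y = trans (z-transpose-merge ψ p≁q) (cong suc (z-transpose-merge ρ x≁y))

  z-transpose²-no-drop : p ≢ q → x ≢ y → ¬ (¬ SameOrbit ψ p q × ¬ SameOrbit ρ x y) →
                         z ψ″ ≡ z ψ ⊎ z ψ″ ≡ 2 + z ψ
  z-transpose²-no-drop p≢q x≢y ¬drop with Orbits._∼?_ ψ p q | Orbits._∼?_ ρ x y
  ... | yes p∼q | yes x∼y = inj₂ (trans (z-transpose-split ρ x≢y x∼y) (cong suc (z-transpose-split ψ p≢q p∼q)))
  ... | yes p∼q | no x≁y  =
    inj₁ (ℕ.suc-injective (trans (sym (z-transpose-merge ρ x≁y)) (z-transpose-split ψ p≢q p∼q)))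
  ... | no p≁q  | yes x∼y = inj₁ (trans (z-transpose-split ρ x≢y x∼y) (sym (z-transpose-merge ψ p≁q)))
  ... | no p≁q  | no x≁y  = contradiction (p≁q , x≁y) ¬drop

reach-trans : ∀ {n} {σ τ : Permutation′ n} {x y w} → Reach σ τ x y → Reach σ τ y w → Reach σ τ x w
reach-trans r here       = r
reach-trans r (step∘ s)  = step∘ (reach-trans r s)
reach-trans r (step• s)  = step• (reach-trans r s)
reach-trans r (step∘⁻ s) = step∘⁻ (reach-trans r s)
reach-trans r (step•⁻ s) = step•⁻ (reach-trans r s)

transitive-coarsen : ∀ {n} {σ σ′ τ : Permutation′ n} →
                     (∀ {u v} → SameOrbit (σ · τ) u v → SameOrbit (σ′ · τ) u v) →
                     Transitive σ τ → Transitive σ′ τ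
transitive-coarsen {σ = σ} {σ′} {τ} coarser transitive x y = transfer (transitive x y)
  where
    open Orbits (σ · τ) using (∼-step; ∼-sym)

    reach-iter : ∀ k u → Reach σ′ τ u (iter (σ′ · τ) k u)
    reach-iter zero    u = here
    reach-iter (suc k) u = step∘ (step• (reach-iter k u))

    reach-orbit : ∀ {u v} → SameOrbit (σ · τ) u v → Reach σ′ τ u v
    reach-orbit u∼v with coarser u∼v
    ... | k , refl = reach-iter k _

    -- σ w = (σ · τ) (τ⁻¹ w) and σ⁻¹ w = τ ((σ · τ)⁻¹ w): a σ-step is a τ-step plus a move within a face.
    transfer : ∀ {u v} → Reach σ τ u v → Reach σ′ τ u v
    transfer here       = here
    transfer (step• r)  = step• (transfer r)
    transfer (step•⁻ r) = step•⁻ (transfer r)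
    transfer (step∘ {y = w} r) =
      reach-trans (step•⁻ (transfer r))
        (subst (Reach σ′ τ _) (cong (σ ⟨$⟩ʳ_) (inverseʳ τ)) (reach-orbit (∼-step (flip τ ⟨$⟩ʳ w))))
    transfer (step∘⁻ {y = w} r) =
      subst (Reach σ′ τ _) (inverseʳ τ)
        (step• (reach-trans (transfer r) (reach-orbit (∼-sym u∼w))))
      where
        u : Fin _
        u = flip τ ⟨$⟩ʳ (flip σ ⟨$⟩ʳ w)
        u∼w : SameOrbit (σ · τ) u w
        u∼w = subst (SameOrbit (σ · τ) u) (trans (cong (σ ⟨$⟩ʳ_) (inverseʳ τ)) (inverseʳ σ)) (∼-step u)

separated⇔merging : ∀ {n} (φ : Permutation′ n) (a a′ b b′ : Fin n) →
  ((Separated φ a a′ b b′ ⊎ Separated φ b a a′ b′) × (Separated φ a′ a b b′ ⊎ Separated φ b′ a a′ b))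
  ⇔ (¬ SameOrbit φ a′ b′ × ¬ SameOrbit (transpose a′ b′ · φ) a b)
separated⇔merging φ a a′ b b′ = mk⇔
  (λ (c₁ , c₂) → let a′≁b′ = separated⇒a′≁b′ c₂ in
    a′≁b′ , separated⇒¬merged c₁ ∘ to (sameOrbit-transpose⇔ φ a′≁b′))
  (λ (a′≁b′ , a≁ρb) → let merged = a≁ρb ∘ from (sameOrbit-transpose⇔ φ a′≁b′) in
    separated a′≁b′ (merged ∘ inj₁) (merged ∘ inj₂))
  where
    open Orbits φ using (_∼_; _∼?_; ∼-sym; ∼-trans)
    Near : Fin _ → Set
    Near = InOrbitsOf φ a′ b′

    separated⇒a′≁b′ : Separated φ a′ a b b′ ⊎ Separated φ b′ a a′ b → ¬ a′ ∼ b′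
    separated⇒a′≁b′ (inj₁ (_ , _ , a′≁b′)) = a′≁b′
    separated⇒a′≁b′ (inj₂ (_ , b′≁a′ , _)) = b′≁a′ ∘ ∼-sym

    separated⇒¬merged : Separated φ a a′ b b′ ⊎ Separated φ b a a′ b′ → ¬ (a ∼ b ⊎ (Near a × Near b))
    separated⇒¬merged (inj₁ (_ , a≁b , _))          (inj₁ a∼b)           = a≁b a∼b
    separated⇒¬merged (inj₂ (b≁a , _ , _))          (inj₁ a∼b)           = b≁a (∼-sym a∼b)
    separated⇒¬merged (inj₁ (a≁a′ , _ , a≁b′))      (inj₂ (a-near , _))  = Sum.[ a≁a′ , a≁b′ ]′ a-near
    separated⇒¬merged (inj₂ (_ , b≁a′ , b≁b′))      (inj₂ (_ , b-near))  = Sum.[ b≁a′ , b≁b′ ]′ b-near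

    separated : ¬ a′ ∼ b′ → ¬ a ∼ b → ¬ (Near a × Near b) →
                (Separated φ a a′ b b′ ⊎ Separated φ b a a′ b′) ×
                (Separated φ a′ a b b′ ⊎ Separated φ b′ a a′ b)
    separated a′≁b′ a≁b ¬near with (a ∼? a′) ⊎-dec (a ∼? b′)
    ... | no a-far = inj₁ (a-far ∘ inj₁ , a≁b , a-far ∘ inj₂) , a′-or-b′ (a′ ∼? b)
      where
        a′-or-b′ : Dec (a′ ∼ b) → Separated φ a′ a b b′ ⊎ Separated φ b′ a a′ b
        a′-or-b′ (no a′≁b)  = inj₁ (a-far ∘ inj₁ ∘ ∼-sym , a′≁b , a′≁b′)
        a′-or-b′ (yes a′∼b) =
          inj₂ (a-far ∘ inj₂ ∘ ∼-sym , a′≁b′ ∘ ∼-sym , λ b′∼b → a′≁b′ (∼-trans a′∼b (∼-sym b′∼b)))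
    ... | yes a-near = inj₂ (a≁b ∘ ∼-sym , b-far ∘ inj₁ , b-far ∘ inj₂) , a-partner a-near
      where
        b-far : ¬ Near b
        b-far b-near = ¬near (a-near , b-near)
        a-partner : Near a → Separated φ a′ a b b′ ⊎ Separated φ b′ a a′ b
        a-partner (inj₁ a∼a′) =
          inj₂ ((λ b′∼a → a′≁b′ (∼-sym (∼-trans b′∼a a∼a′))) , a′≁b′ ∘ ∼-sym , b-far ∘ inj₂ ∘ ∼-sym)
        a-partner (inj₂ a∼b′) =
          inj₁ ((λ a′∼a → a′≁b′ (∼-trans a′∼a a∼b′)) , b-far ∘ inj₁ ∘ ∼-sym , a′≁b′)

halve-+2 : ∀ c → (c ℤ.+ + 2) / 2 ≡ c / 2 ℚ.+ 1ℚ
halve-+2 c = ℚ.toℚᵘ-injective (begin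
  toℚᵘ ((c ℤ.+ + 2) / 2)       ≈⟨ ℚ.toℚᵘ-fromℚᵘ (mkℚᵘ (c ℤ.+ + 2) 1) ⟩
  mkℚᵘ (c ℤ.+ + 2) 1           ≈⟨ *≡* (numerators c) ⟩
  mkℚᵘ c 1 ℚᵘ.+ ℚᵘ.1ℚᵘ         ≈⟨ ℚᵘ.+-congˡ ℚᵘ.1ℚᵘ (ℚ.toℚᵘ-fromℚᵘ (mkℚᵘ c 1)) ⟨
  toℚᵘ (c / 2) ℚᵘ.+ toℚᵘ 1ℚ    ≈⟨ ℚ.toℚᵘ-homo-+ (c / 2) 1ℚ ⟨
  toℚᵘ (c / 2 ℚ.+ 1ℚ)          ∎)
  where
    open ℚᵘ.≃-Reasoning
    numerators : ∀ c → (c ℤ.+ + 2) ℤ.* (+ 2 ℤ.* + 1) ≡ (c ℤ.* + 1 ℤ.+ + 1 ℤ.* + 2) ℤ.* + 2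
    numerators = solve-∀

-- genus σ∘ σ• is definitionally genusOf (z σ∘ + z σ• − n) (z (σ∘ · σ•)).
genusOf : ℤ → ℕ → ℚ
genusOf k f = 1ℚ - (k ℤ.+ + f) / 2

genusOf-+2 : ∀ k f → genusOf k f ≡ genusOf k (2 + f) ℚ.+ 1ℚ
genusOf-+2 k f = begin
  1ℚ - (k ℤ.+ + f) / 2                          ≡⟨ shift-by-one ((k ℤ.+ + f) / 2) ⟩
  1ℚ - ((k ℤ.+ + f) / 2 ℚ.+ 1ℚ) ℚ.+ 1ℚ          ≡⟨ cong (λ h → 1ℚ - h ℚ.+ 1ℚ) (halve-+2 (k ℤ.+ + f)) ⟨
  1ℚ - ((k ℤ.+ + f) ℤ.+ + 2) / 2 ℚ.+ 1ℚ         ≡⟨ cong (λ c → 1ℚ - c / 2 ℚ.+ 1ℚ) k+[2+f]≡k+f+2 ⟨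
  1ℚ - (k ℤ.+ + (2 + f)) / 2 ℚ.+ 1ℚ             ∎
  where
    open ≡-Reasoning
    open ℚ.+-*-Solver
    shift-by-one : ∀ h → 1ℚ - h ≡ 1ℚ - (h ℚ.+ 1ℚ) ℚ.+ 1ℚ
    shift-by-one = solve 1 (λ h → con 1ℚ :- h := (con 1ℚ :- (h :+ con 1ℚ)) :+ con 1ℚ) refl
    k+[2+f]≡k+f+2 : k ℤ.+ + (2 + f) ≡ (k ℤ.+ + f) ℤ.+ + 2
    k+[2+f]≡k+f+2 = trans (cong (λ m → k ℤ.+ + m) (ℕ.+-comm 2 f)) (sym (ℤ.+-assoc k (+ f) (+ 2)))

p<p+1 : ∀ p → p ℚ.< p ℚ.+ 1ℚ
p<p+1 p = subst (ℚ._< p ℚ.+ 1ℚ) (ℚ.+-identityʳ p) (ℚ.+-monoʳ-< p (ℚ.positive⁻¹ 1ℚ))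

genusOf-rises : ∀ k {f f″} → f ≡ 2 + f″ → genusOf k f″ ≡ genusOf k f ℚ.+ 1ℚ
genusOf-rises k {f″ = f″} refl = genusOf-+2 k f″

genusOf-does-not-rise : ∀ k {f f″} → f″ ≡ f ⊎ f″ ≡ 2 + f → ¬ genusOf k f ℚ.< genusOf k f″
genusOf-does-not-rise k (inj₁ refl) = ℚ.<-irrefl refl
genusOf-does-not-rise k {f} (inj₂ refl) g<g″ =
  ℚ.<-asym g<g″ (subst (genusOf k (2 + f) ℚ.<_) (sym (genusOf-+2 k f)) (p<p+1 _))

module ConjugatedPair {n} (σ∘ σ• : Permutation′ n) {a b : Fin n} (a≢b : a ≢ b) where

  σa σb : Fin n
  σa = σ∘ ⟨$⟩ʳ a
  σb = σ∘ ⟨$⟩ʳ b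

  φ ρ σ∘ᵗ : Permutation′ n
  φ = σ∘ · σ•
  ρ = transpose σa σb · φ
  σ∘ᵗ = conj σ∘ (transpose a b)

  Merges : Set
  Merges = ¬ SameOrbit φ σa σb × ¬ SameOrbit ρ a b

  separated⇔merges : ((Separated φ a σa b σb ⊎ Separated φ b a σa σb) ×
                      (Separated φ σa a b σb ⊎ Separated φ σb a σa b)) ⇔ Merges
  separated⇔merges = separated⇔merging φ a σa b σb

  merges? : Dec Merges
  merges? = ¬? (Orbits._∼?_ φ σa σb) ×-dec ¬? (Orbits._∼?_ ρ a b)

  private
    K : ℤ
    K = + z σ∘ ℤ.+ + z σ• ℤ.- + n

    faces-conj : σ∘ᵗ · σ• ≈ transpose a b · ρ
    faces-conj e = conj-transpose σ∘ a b (σ• ⟨$⟩ʳ e)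

    genus-conj : genus σ∘ᵗ σ• ≡ genusOf K (z (transpose a b · ρ))
    genus-conj = cong₂ (λ zσ zφ → genusOf (+ zσ ℤ.+ + z σ• ℤ.- + n) zφ)
                       (z-conj-transpose σ∘ a≢b) (z-cong faces-conj)

  merges⇒genus+1 : Merges → genus σ∘ᵗ σ• ≡ genus σ∘ σ• ℚ.+ 1ℚ
  merges⇒genus+1 (σa≁σb , a≁b) = trans genus-conj (genusOf-rises K (z-transpose²-drop φ σa≁σb a≁b))

  merges⇒genus-rises : Merges → genus σ∘ σ• ℚ.< genus σ∘ᵗ σ•
  merges⇒genus-rises m = subst (genus σ∘ σ• ℚ.<_) (sym (merges⇒genus+1 m)) (p<p+1 _)

  ¬merges⇒¬genus-rises : ¬ Merges → ¬ genus σ∘ σ• ℚ.< genus σ∘ᵗ σ•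
  ¬merges⇒¬genus-rises ¬m =
    genusOf-does-not-rise K (z-transpose²-no-drop φ (a≢b ∘ Orbits.π-injective σ∘) a≢b ¬m)
    ∘ subst (genus σ∘ σ• ℚ.<_) genus-conj

  merges⇒faces-coarsen : Merges → ∀ {u v} → SameOrbit φ u v → SameOrbit (σ∘ᵗ · σ•) u v
  merges⇒faces-coarsen (σa≁σb , a≁b) = sameOrbit-cong (sym ∘ faces-conj) ∘ coarsen ρ a≁b ∘ coarsen φ σa≁σb
    where
      coarsen : ∀ ψ {x y} → ¬ SameOrbit ψ x y → ∀ {u v} → SameOrbit ψ u v → SameOrbit (transpose x y · ψ) u v
      coarsen ψ x≁y = from (sameOrbit-transpose⇔ ψ x≁y) ∘ inj₁

mainTheorem6 : ∀ {n : ℕ} (σ∘ σ• : Permutation′ n) (a b : Fin n) → ¬ a ≡ b →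
    let t = transpose a b
        φ = σ∘ · σ•
        sa = σ∘ ⟨$⟩ʳ a
        sb = σ∘ ⟨$⟩ʳ b
        g = genus σ∘ σ•
        gt = genus (conj σ∘ t) σ•
        cond1 = Separated φ a sa b sb ⊎ Separated φ b a sa sb
        cond2 = Separated φ sa a b sb ⊎ Separated φ sb a sa b
    in ((g ℚ.< gt) ⇔ (cond1 × cond2))
       × (g ℚ.< gt → gt ≡ g ℚ.+ 1ℚ × (Transitive σ∘ σ• → Transitive (conj σ∘ t) σ•))
mainTheorem6 σ∘ σ• a b a≢b with ConjugatedPair.merges? σ∘ σ• a≢b
... | yes m = mk⇔ (λ _ → from separated⇔merges m) (λ _ → merges⇒genus-rises m)
            , λ _ → merges⇒genus+1 m , transitive-coarsen (merges⇒faces-coarsen m)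
  where open ConjugatedPair σ∘ σ• a≢b
... | no ¬m = mk⇔ (⊥-elim ∘ no-rise) (⊥-elim ∘ ¬m ∘ to separated⇔merges) , ⊥-elim ∘ no-rise
  where
    open ConjugatedPair σ∘ σ• a≢b
    no-rise : ¬ genus σ∘ σ• ℚ.< genus σ∘ᵗ σ•
    no-rise = ¬merges⇒¬genus-rises ¬m
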